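{- Let $n=sp^k$, where $s>1$ is a squarefree integer, $p$ is a prime not dividing $s$, and $k$ is a positive integer. Then $$I_r(\mathbb{Z}/n\mathbb{Z}) \leq \mathsf{D}((\mathbb{Z}/n\mathbb{Z})^\times) + (k - 1)+(\phi(s)-1),$$ where $\phi$ is Euler's totient function.
   Context: For a finite commutative ring $R$, $I_r(R)$ (the Erdős–Burgess constant of the multiplicative semigroup of $R$) is the smallest positive integer $t$ such that every sequence of $t$ (not necessarily distinct) elements of $R$ contains a nonempty subsequence whose elements multiply to an idempotent element of $R$ (an element $x$ with $x^2=x$). For a finite abelian group $G$, the Davenport constant $\mathsf{D}(G)$ is the smallest positive integer $t$ such that every sequence of $t$ elements of $G$ contains a nonempty subsequence whose elements multiply (in the group operation) to the identity. $(\mathbb{Z}/n\mathbb{Z})^\times$ denotes the unit group of $\mathbb{Z}/n\mathbb{Z}$. -}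

module Defs where

open import Data.Nat using (ℕ; zero; suc; _*_; _≤_; _<_)
open import Data.Nat.DivMod using (_%_)
open import Data.Nat.Divisibility using (_∣_)
open import Data.Nat.Coprimality using (Coprime; coprime?)
open import Data.Fin using (Fin; toℕ)
open import Data.Vec using (Vec; []; _∷_)
open import Data.Bool using (Bool; true; false)
open import Data.List using (List; length; filter; map; upTo)
open import Data.Vec.Relation.Unary.All using (All)
open import Data.Vec.Relation.Unary.Any using (Any)
open import Data.Product using (Σ; _×_)
open import Relation.Binary.PropositionalEquality using (_≡_)

-- Reduction modulo n (for n = 0 it is the identity; only n ≥ 1 is used).
_mod'_ : ℕ → ℕ → ℕ
a mod' zero    = a
a mod' (suc m) = a % suc m

-- Elements of ℤ/nℤ are represented by Fin n (canonical residues 0..n-1).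
selProd : (n : ℕ) {t : ℕ} → Vec Bool t → Vec (Fin n) t → ℕ
selProd n []           []       = 1 mod' n
selProd n (true  ∷ bs) (x ∷ xs) = (toℕ x * selProd n bs xs) mod' n
selProd n (false ∷ bs) (x ∷ xs) = selProd n bs xs

NonEmptyMask : {t : ℕ} → Vec Bool t → Set
NonEmptyMask bs = Any (λ b → b ≡ true) bs

IsIdempotent : (n : ℕ) → ℕ → Set
IsIdempotent n x = (x * x) mod' n ≡ x mod' n

EBProperty : ℕ → ℕ → Set
EBProperty n t = (xs : Vec (Fin n) t) →
  Σ (Vec Bool t) (λ bs → NonEmptyMask bs × IsIdempotent n (selProd n bs xs))

IsErdosBurgessConst : ℕ → ℕ → Set
IsErdosBurgessConst n I =
  1 ≤ I × EBProperty n I × ((t : ℕ) → 1 ≤ t → EBProperty n t → I ≤ t)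

IsUnit : (n : ℕ) → Fin n → Set
IsUnit n x = Coprime (toℕ x) n

DavenportProperty : ℕ → ℕ → Set
DavenportProperty n t = (xs : Vec (Fin n) t) → All (IsUnit n) xs →
  Σ (Vec Bool t) (λ bs → NonEmptyMask bs × selProd n bs xs ≡ 1 mod' n)

IsDavenportConst : ℕ → ℕ → Set
IsDavenportConst n D =
  1 ≤ D × DavenportProperty n D × ((t : ℕ) → 1 ≤ t → DavenportProperty n t → D ≤ t)

SquareFree : ℕ → Set
SquareFree s = (d : ℕ) → d * d ∣ s → d ≡ 1

φ : ℕ → ℕ
φ m = length (filter (λ i → coprime? i m) (map suc (upTo m)))

-- Split the sequence into the terms divisible by p and the rest. If at least D terms are prime to p,
-- replace each such y by y + n / gcd(y, n): as n is squarefree apart from p^k and p ∤ y, gcd(y, n) and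
-- n / gcd(y, n) are coprime, so this is a unit. A Davenport subsequence of these units has product
-- V ≡ 1 (mod n), and the product P of the original terms satisfies P ≡ 0 modulo gcd(P, n) and
-- P ≡ V ≡ 1 modulo n / gcd(P, n), hence P² ≡ P (mod n) by the Chinese remainder theorem.
-- Otherwise at least k + φ(s) − 1 terms are multiples of p. Any φ(s) units modulo s contain a
-- nonempty subsequence with product 1 (pigeonhole on prefix products), so repeatedly extracting such
-- subsequences, after the same shift modulo s, gives at least k multiples of p whose product P is
-- idempotent modulo s and divisible by p^k, hence idempotent modulo n = s p^k.
module Submission where

open import Defs
open import Data.Bool using (Bool; true; false; not)
open import Data.Empty using (⊥-elim)
open import Data.Fin using (Fin; toℕ; fromℕ<)
open import Data.Fin.Properties using (pigeonhole; toℕ≤pred[n]; toℕ-fromℕ<)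
open import Data.List using (List; filter; upTo; lookup)
import Data.List as List
open import Data.List.Membership.Propositional using (_∈_)
open import Data.List.Membership.Propositional.Properties using (∈-filter⁺; ∈-map⁺; ∈-upTo⁺)
open import Data.List.Relation.Unary.Any using (index)
open import Data.List.Relation.Unary.Any.Properties using (lookup-index)
open import Data.Nat
open import Data.Nat.Properties
open import Data.Nat.DivMod using (_%_; _/_; m≡m%n+[m/n]*n; [m+kn]%n≡m%n; m%n<n)
open import Data.Nat.Divisibility
open import Data.Nat.GCD using (gcd; gcd[m,n]∣m; gcd[m,n]∣n; gcd-greatest; gcd[m,n]≡0⇒n≡0)
open import Data.Nat.Coprimality
  using (Coprime; coprime?; coprime-divisor; 1-coprimeTo; 0-coprimeTo-m⇒m≡1) renaming (sym to coprime-sym)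
open import Data.Nat.Primality using (Prime; prime⇒irreducible; prime⇒nonZero)
open import Data.Nat.Tactic.RingSolver using (solve-∀)
open import Data.Product using (Σ; ∃₂; _×_; _,_; proj₁)
open import Data.Sum using (inj₁; inj₂)
open import Data.Vec using (Vec; []; _∷_; _++_; replicate; splitAt; map)
open import Data.Vec.Relation.Unary.All using (All; []; _∷_; universal) renaming (map to All-map)
open import Data.Vec.Relation.Unary.All.Properties using (++⁻; map⁺)
open import Data.Vec.Relation.Unary.Any using (here; there)
open import Data.Vec.Relation.Unary.Any.Properties using (++⁺ˡ)
open import Function using (_∘_)
open import Relation.Binary.Consequences using (wlog)
open import Relation.Binary.PropositionalEquality
open import Relation.Nullary using (¬_; Dec; yes; no; does)
open import Relation.Unary using (Decidable)

-- Congruence modulo m, stated without subtraction and without requiring m ≠ 0.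
infix 4 _≡_mod_

_≡_mod_ : ℕ → ℕ → ℕ → Set
a ≡ b mod m = ∃₂ λ i j → a + i * m ≡ b + j * m

≡mod-refl : ∀ {m} a → a ≡ a mod m
≡mod-refl a = 0 , 0 , refl

≡mod-sym : ∀ {m a b} → a ≡ b mod m → b ≡ a mod m
≡mod-sym (i , j , e) = j , i , sym e

≡mod-trans : ∀ {m a b c} → a ≡ b mod m → b ≡ c mod m → a ≡ c mod m
≡mod-trans {m} {a} {b} {c} (i , j , a≡b) (i′ , j′ , b≡c) = i + i′ , j′ + j , (begin
  a + (i + i′) * m      ≡⟨ regroup a i i′ m ⟩
  (a + i * m) + i′ * m  ≡⟨ cong (_+ i′ * m) a≡b ⟩
  (b + j * m) + i′ * m  ≡⟨ swap b j i′ m ⟩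
  (b + i′ * m) + j * m  ≡⟨ cong (_+ j * m) b≡c ⟩
  (c + j′ * m) + j * m  ≡⟨ regroup c j′ j m ⟨
  c + (j′ + j) * m      ∎)
  where
  open ≡-Reasoning
  regroup : ∀ x y z w → x + (y + z) * w ≡ (x + y * w) + z * w
  regroup = solve-∀
  swap : ∀ x y z w → (x + y * w) + z * w ≡ (x + z * w) + y * w
  swap = solve-∀

≡mod-*-cong : ∀ {m a b c d} → a ≡ b mod m → c ≡ d mod m → a * c ≡ b * d mod m
≡mod-*-cong {m} {a} {b} {c} {d} (i , j , a≡b) (i′ , j′ , c≡d) =
  a * i′ + i * c + i * i′ * m , b * j′ + j * d + j * j′ * m , (begin
  a * c + (a * i′ + i * c + i * i′ * m) * m  ≡⟨ expand a c i i′ m ⟩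
  (a + i * m) * (c + i′ * m)                 ≡⟨ cong₂ _*_ a≡b c≡d ⟩
  (b + j * m) * (d + j′ * m)                 ≡⟨ expand b d j j′ m ⟨
  b * d + (b * j′ + j * d + j * j′ * m) * m  ∎)
  where
  open ≡-Reasoning
  expand : ∀ x y u v w → x * y + (x * v + u * y + u * v * w) * w ≡ (x + u * w) * (y + v * w)
  expand = solve-∀

≡mod-∣ : ∀ {m d a b} → d ∣ m → a ≡ b mod m → a ≡ b mod d
≡mod-∣ {d = d} {a} {b} (divides q refl) (i , j , e) = i * q , j * q , (begin
  a + i * q * d    ≡⟨ cong (a +_) (*-assoc i q d) ⟩
  a + i * (q * d)  ≡⟨ e ⟩
  b + j * (q * d)  ≡⟨ cong (b +_) (*-assoc j q d) ⟨
  b + j * q * d    ∎)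
  where open ≡-Reasoning

%-≡mod : ∀ {m} .{{_ : NonZero m}} a → a % m ≡ a mod m
%-≡mod {m} a = a / m , 0 , trans (sym (m≡m%n+[m/n]*n a m)) (sym (+-identityʳ a))

≡mod⇒%≡ : ∀ {m} .{{_ : NonZero m}} {a b} → a ≡ b mod m → a % m ≡ b % m
≡mod⇒%≡ {m} {a} {b} (i , j , e) =
  trans (sym ([m+kn]%n≡m%n a i m)) (trans (cong (_% m) e) ([m+kn]%n≡m%n b j m))

%≡⇒≡mod : ∀ {m} .{{_ : NonZero m}} {a b} → a % m ≡ b % m → a ≡ b mod m
%≡⇒≡mod {m} {a} {b} e = ≡mod-trans (≡mod-sym (%-≡mod a)) (subst (_≡ b mod m) (sym e) (%-≡mod b))

∣⇒≡0mod : ∀ {m a} → m ∣ a → a ≡ 0 mod m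
∣⇒≡0mod (divides q refl) = 0 , q , +-identityʳ _

≡0mod⇒square≡ : ∀ {m a} → a ≡ 0 mod m → a * a ≡ a mod m
≡0mod⇒square≡ {m} {a} a≡0 =
  ≡mod-trans (subst (a * a ≡_mod m) (*-zeroʳ a) (≡mod-*-cong (≡mod-refl a) a≡0)) (≡mod-sym a≡0)

≡1mod⇒square≡ : ∀ {m a} → a ≡ 1 mod m → a * a ≡ a mod m
≡1mod⇒square≡ {m} {a} a≡1 = subst (a * a ≡_mod m) (*-identityʳ a) (≡mod-*-cong (≡mod-refl a) a≡1)

≡mod-+⇒∣ : ∀ {m} a δ → a ≡ a + δ mod m → m ∣ δ
≡mod-+⇒∣ {m} a δ (i , j , e) = ∣m+n∣m⇒∣n (subst (m ∣_) i*m≡j*m+δ (n∣m*n i)) (n∣m*n j)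
  where
  i*m≡j*m+δ : i * m ≡ j * m + δ
  i*m≡j*m+δ = +-cancelˡ-≡ a _ _ (trans e (trans (+-assoc a δ (j * m)) (cong (a +_) (+-comm δ (j * m)))))

∣⇒≡mod-+ : ∀ {m} a {δ} → m ∣ δ → a ≡ a + δ mod m
∣⇒≡mod-+ a (divides q refl) = q , 0 , sym (+-identityʳ _)

≡mod⇒∣∣-∣ : ∀ {m} a b → a ≡ b mod m → m ∣ ∣ a - b ∣
≡mod⇒∣∣-∣ {m} = wlog ≤-total (λ {a} {b} h e → subst (m ∣_) (∣-∣-comm a b) (h (≡mod-sym e))) ordered
  where
  ordered : ∀ a b → a ≤ b → a ≡ b mod m → m ∣ ∣ a - b ∣
  ordered a b a≤b with δ , refl ← m≤n⇒∃[o]m+o≡n a≤b =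
    λ e → subst (m ∣_) (sym (∣m-m+n∣≡n a δ)) (≡mod-+⇒∣ a δ e)

∣∣-∣⇒≡mod : ∀ {m} a b → m ∣ ∣ a - b ∣ → a ≡ b mod m
∣∣-∣⇒≡mod {m} = wlog ≤-total (λ {a} {b} h d → ≡mod-sym (h (subst (m ∣_) (∣-∣-comm b a) d))) ordered
  where
  ordered : ∀ a b → a ≤ b → m ∣ ∣ a - b ∣ → a ≡ b mod m
  ordered a b a≤b with δ , refl ← m≤n⇒∃[o]m+o≡n a≤b = λ d → ∣⇒≡mod-+ a (subst (m ∣_) (∣m-m+n∣≡n a δ) d)

coprime⇒*∣ : ∀ {m₁ m₂ d} → Coprime m₁ m₂ → m₁ ∣ d → m₂ ∣ d → m₁ * m₂ ∣ d
coprime⇒*∣ {m₁} {m₂} c (divides q refl) m₂∣q*m₁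
  with divides r refl ← coprime-divisor (coprime-sym c) (subst (m₂ ∣_) (*-comm q m₁) m₂∣q*m₁) =
  divides r (trans (*-assoc r m₂ m₁) (cong (r *_) (*-comm m₂ m₁)))

≡mod-crt : ∀ {m₁ m₂ a b} → Coprime m₁ m₂ → a ≡ b mod m₁ → a ≡ b mod m₂ → a ≡ b mod (m₁ * m₂)
≡mod-crt {a = a} {b} c e₁ e₂ = ∣∣-∣⇒≡mod a b (coprime⇒*∣ c (≡mod⇒∣∣-∣ a b e₁) (≡mod⇒∣∣-∣ a b e₂))

≡mod-cancelˡ : ∀ {m c a b} → Coprime c m → c * a ≡ c * b mod m → a ≡ b mod m
≡mod-cancelˡ {m} {c} {a} {b} c⊥m e = ∣∣-∣⇒≡mod a b
  (coprime-divisor (coprime-sym c⊥m) (subst (m ∣_) (sym (*-distribˡ-∣-∣ c a b)) (≡mod⇒∣∣-∣ _ _ e)))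

-- Subsequences selected by Boolean masks

count : ∀ {t} → Vec Bool t → ℕ
count []           = 0
count (true  ∷ bs) = suc (count bs)
count (false ∷ bs) = count bs

maskProd : ∀ {A : Set} {t} → (A → ℕ) → Vec Bool t → Vec A t → ℕ
maskProd f []           []       = 1
maskProd f (true  ∷ bs) (x ∷ xs) = f x * maskProd f bs xs
maskProd f (false ∷ bs) (x ∷ xs) = maskProd f bs xs

pick : ∀ {A : Set} {t} (c : Vec Bool t) → Vec A t → Vec A (count c)
pick []          []       = []
pick (true  ∷ c) (x ∷ xs) = x ∷ pick c xs
pick (false ∷ c) (x ∷ xs) = pick c xs

embed : ∀ {t} (c : Vec Bool t) → Vec Bool (count c) → Vec Bool t
embed []          []       = []
embed (true  ∷ c) (b ∷ bs) = b ∷ embed c bs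
embed (false ∷ c) bs       = false ∷ embed c bs

maskProd-embed : ∀ {A : Set} {t} (f : A → ℕ) (c : Vec Bool t) b xs →
  maskProd f (embed c b) xs ≡ maskProd f b (pick c xs)
maskProd-embed f []          []          []       = refl
maskProd-embed f (true  ∷ c) (true  ∷ b) (x ∷ xs) = cong (f x *_) (maskProd-embed f c b xs)
maskProd-embed f (true  ∷ c) (false ∷ b) (x ∷ xs) = maskProd-embed f c b xs
maskProd-embed f (false ∷ c) b           (x ∷ xs) = maskProd-embed f c b xs

embed-nonEmpty : ∀ {t} (c : Vec Bool t) b → NonEmptyMask b → NonEmptyMask (embed c b)
embed-nonEmpty (true  ∷ c) (b ∷ bs) (here b≡true) = here b≡true
embed-nonEmpty (true  ∷ c) (b ∷ bs) (there ne)    = there (embed-nonEmpty c bs ne)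
embed-nonEmpty (false ∷ c) bs       ne            = there (embed-nonEmpty c bs ne)

nonEmpty⇒1≤count : ∀ {t} (b : Vec Bool t) → NonEmptyMask b → 1 ≤ count b
nonEmpty⇒1≤count (true  ∷ b) _          = s≤s z≤n
nonEmpty⇒1≤count (false ∷ b) (there ne) = nonEmpty⇒1≤count b ne

1≤count⇒nonEmpty : ∀ {t} (b : Vec Bool t) → 1 ≤ count b → NonEmptyMask b
1≤count⇒nonEmpty (true  ∷ b) _   = here refl
1≤count⇒nonEmpty (false ∷ b) 1≤c = there (1≤count⇒nonEmpty b 1≤c)

All-pick : ∀ {A : Set} {P : A → Set} {t} (c : Vec Bool t) {xs} → All P xs → All P (pick c xs)
All-pick []          []       = []
All-pick (true  ∷ c) (p ∷ ps) = p ∷ All-pick c ps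
All-pick (false ∷ c) (p ∷ ps) = All-pick c ps

∁ : ∀ {t} → Vec Bool t → Vec Bool t
∁ = map not

count-∁ : ∀ {t} (c : Vec Bool t) → count (∁ c) + count c ≡ t
count-∁ []          = refl
count-∁ (true  ∷ c) = trans (+-suc _ _) (cong suc (count-∁ c))
count-∁ (false ∷ c) = cong suc (count-∁ c)

satisfying : ∀ {A : Set} {P : A → Set} → Decidable P → ∀ {t} → Vec A t → Vec Bool t
satisfying P? []       = []
satisfying P? (x ∷ xs) = does (P? x) ∷ satisfying P? xs

All-pick-satisfying : ∀ {A : Set} {P : A → Set} (P? : Decidable P) {t} (xs : Vec A t) →
  All P (pick (satisfying P? xs) xs)
All-pick-satisfying P? []       = []
All-pick-satisfying P? (x ∷ xs) with P? x
... | yes p = p ∷ All-pick-satisfying P? xs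
... | no  _ = All-pick-satisfying P? xs

All-pick-∁satisfying : ∀ {A : Set} {P : A → Set} (P? : Decidable P) {t} (xs : Vec A t) →
  All (¬_ ∘ P) (pick (∁ (satisfying P? xs)) xs)
All-pick-∁satisfying P? []       = []
All-pick-∁satisfying P? (x ∷ xs) with P? x
... | yes _  = All-pick-∁satisfying P? xs
... | no  ¬p = ¬p ∷ All-pick-∁satisfying P? xs

merge : ∀ {t} (c : Vec Bool t) → Vec Bool (count (∁ c)) → Vec Bool t
merge []          []       = []
merge (true  ∷ c) b        = true ∷ merge c b
merge (false ∷ c) (b ∷ bs) = b ∷ merge c bs

maskProd-merge : ∀ {A : Set} {t} (f : A → ℕ) (c : Vec Bool t) b xs →
  maskProd f (merge c b) xs ≡ maskProd f b (pick (∁ c) xs) * maskProd f c xs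
maskProd-merge f []          []          []       = refl
maskProd-merge f (true  ∷ c) b           (x ∷ xs) =
  trans (cong (f x *_) (maskProd-merge f c b xs))
        (x∙yz≡y∙xz (f x) (maskProd f b (pick (∁ c) xs)) (maskProd f c xs))
  where
  x∙yz≡y∙xz : ∀ x y z → x * (y * z) ≡ y * (x * z)
  x∙yz≡y∙xz = solve-∀
maskProd-merge f (false ∷ c) (true  ∷ b) (x ∷ xs) =
  trans (cong (f x *_) (maskProd-merge f c b xs)) (sym (*-assoc (f x) _ _))
maskProd-merge f (false ∷ c) (false ∷ b) (x ∷ xs) = maskProd-merge f c b xs

count-merge : ∀ {t} (c : Vec Bool t) b → count (merge c b) ≡ count b + count c
count-merge []          []          = refl
count-merge (true  ∷ c) b           = trans (cong suc (count-merge c b)) (sym (+-suc _ _))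
count-merge (false ∷ c) (true  ∷ b) = cong suc (count-merge c b)
count-merge (false ∷ c) (false ∷ b) = count-merge c b

maskProd-cong : ∀ {A : Set} {m} {f g : A → ℕ} → (∀ x → f x ≡ g x mod m) → ∀ {t} (b : Vec Bool t) xs →
  maskProd f b xs ≡ maskProd g b xs mod m
maskProd-cong f≡g []          []       = ≡mod-refl 1
maskProd-cong f≡g (true  ∷ b) (x ∷ xs) = ≡mod-*-cong (f≡g x) (maskProd-cong f≡g b xs)
maskProd-cong f≡g (false ∷ b) (x ∷ xs) = maskProd-cong f≡g b xs

maskProd-map : ∀ {A B : Set} (f : B → ℕ) (h : A → B) {t} (b : Vec Bool t) xs →
  maskProd f b (map h xs) ≡ maskProd (f ∘ h) b xs
maskProd-map f h []          []       = refl
maskProd-map f h (true  ∷ b) (x ∷ xs) = cong (f (h x) *_) (maskProd-map f h b xs)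
maskProd-map f h (false ∷ b) (x ∷ xs) = maskProd-map f h b xs

^-monoʳ-∣ : ∀ p {i j} → i ≤ j → p ^ i ∣ p ^ j
^-monoʳ-∣ p {j = j} z≤n     = divides (p ^ j) (sym (*-identityʳ (p ^ j)))
^-monoʳ-∣ p         (s≤s i≤j) = *-monoʳ-∣ p (^-monoʳ-∣ p i≤j)

^count∣maskProd : ∀ {A : Set} {p} (f : A → ℕ) {t} (b : Vec Bool t) xs →
  All (λ x → p ∣ f x) xs → p ^ count b ∣ maskProd f b xs
^count∣maskProd f []          []       []         = ∣-refl
^count∣maskProd f (true  ∷ b) (x ∷ xs) (d ∷ ds) = *-pres-∣ d (^count∣maskProd f b xs ds)
^count∣maskProd f (false ∷ b) (x ∷ xs) (d ∷ ds) = ^count∣maskProd f b xs ds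

-- prefix i selects the first i entries, block i j the entries with index in [i, j).
prefix : ∀ {L} → ℕ → Vec Bool L
prefix {zero}  _       = []
prefix {suc L} zero    = false ∷ prefix zero
prefix {suc L} (suc i) = true ∷ prefix i

block : ∀ {L} → ℕ → ℕ → Vec Bool L
block {zero}  _       _       = []
block {suc L} zero    j       = prefix j
block {suc L} (suc i) zero    = false ∷ block i zero
block {suc L} (suc i) (suc j) = false ∷ block i j

maskProd-prefix-zero : ∀ {A : Set} {L} (f : A → ℕ) (xs : Vec A L) → maskProd f (prefix 0) xs ≡ 1
maskProd-prefix-zero f []       = refl
maskProd-prefix-zero f (x ∷ xs) = maskProd-prefix-zero f xs

maskProd-prefix-block : ∀ {A : Set} {L} (f : A → ℕ) (xs : Vec A L) {i j} → i ≤ j →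
  maskProd f (prefix j) xs ≡ maskProd f (prefix i) xs * maskProd f (block i j) xs
maskProd-prefix-block f []       _         = refl
maskProd-prefix-block f (x ∷ xs) {zero} {j} _ =
  sym (trans (cong (_* maskProd f (prefix j) (x ∷ xs)) (maskProd-prefix-zero f (x ∷ xs))) (*-identityˡ _))
maskProd-prefix-block f (x ∷ xs) (s≤s i≤j) =
  trans (cong (f x *_) (maskProd-prefix-block f xs i≤j)) (sym (*-assoc (f x) _ _))

block-nonEmpty : ∀ {L i j} → i < j → j ≤ L → NonEmptyMask (block {L} i j)
block-nonEmpty {suc L} {zero}  {suc j} _         _         = here refl
block-nonEmpty {suc L} {suc i} {suc j} (s≤s i<j) (s≤s j≤L) = there (block-nonEmpty i<j j≤L)

mod′-≡mod : ∀ n .{{_ : NonZero n}} a → a mod' n ≡ a mod n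
mod′-≡mod (suc n) a = %-≡mod a

≡mod⇒mod′≡ : ∀ n .{{_ : NonZero n}} {a b} → a ≡ b mod n → a mod' n ≡ b mod' n
≡mod⇒mod′≡ (suc n) = ≡mod⇒%≡

selProd-≡mod : ∀ n .{{_ : NonZero n}} {t} (bs : Vec Bool t) xs → selProd n bs xs ≡ maskProd toℕ bs xs mod n
selProd-≡mod n []           []       = mod′-≡mod n 1
selProd-≡mod n (true  ∷ bs) (x ∷ xs) =
  ≡mod-trans (mod′-≡mod n _) (≡mod-*-cong (≡mod-refl (toℕ x)) (selProd-≡mod n bs xs))
selProd-≡mod n (false ∷ bs) (x ∷ xs) = selProd-≡mod n bs xs

selProd≡1⇒maskProd≡1 : ∀ n .{{_ : NonZero n}} {t} (bs : Vec Bool t) xs →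
  selProd n bs xs ≡ 1 mod' n → maskProd toℕ bs xs ≡ 1 mod n
selProd≡1⇒maskProd≡1 n bs xs e =
  ≡mod-trans (≡mod-sym (selProd-≡mod n bs xs)) (subst (_≡ 1 mod n) (sym e) (mod′-≡mod n 1))

isIdempotent-selProd : ∀ n .{{_ : NonZero n}} {t} (bs : Vec Bool t) xs →
  let P = maskProd toℕ bs xs in P * P ≡ P mod n → IsIdempotent n (selProd n bs xs)
isIdempotent-selProd n bs xs P²≡P = ≡mod⇒mod′≡ n
  (≡mod-trans (≡mod-*-cong X≡P X≡P) (≡mod-trans P²≡P (≡mod-sym X≡P)))
  where
  X≡P = selProd-≡mod n bs xs

selProd-++-falses : ∀ n {t r} (bs : Vec Bool t) (ys : Vec (Fin n) t) (zs : Vec (Fin n) r) →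
  selProd n (bs ++ replicate r false) (ys ++ zs) ≡ selProd n bs ys
selProd-++-falses n []           []       []       = refl
selProd-++-falses n []           []       (z ∷ zs) = selProd-++-falses n [] [] zs
selProd-++-falses n (true  ∷ bs) (y ∷ ys) zs       =
  cong (λ w → (toℕ y * w) mod' n) (selProd-++-falses n bs ys zs)
selProd-++-falses n (false ∷ bs) (y ∷ ys) zs       = selProd-++-falses n bs ys zs

DavenportProperty-mono : ∀ {n D t} → D ≤ t → DavenportProperty n D → DavenportProperty n t
DavenportProperty-mono {n} {D} D≤t dav with r , refl ← m≤n⇒∃[o]m+o≡n D≤t = extend
  where
  extend : (xs : Vec (Fin n) (D + r)) → All (IsUnit n) xs →
    Σ (Vec Bool (D + r)) (λ bs → NonEmptyMask bs × selProd n bs xs ≡ 1 mod' n)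
  extend xs units with ys , zs , refl ← splitAt D xs
                  with bs , ne , e ← dav ys (proj₁ (++⁻ ys units)) =
    bs ++ replicate r false , ++⁺ˡ ne , trans (selProd-++-falses n bs ys zs) e

coprime-* : ∀ {a b m} → Coprime a m → Coprime b m → Coprime (a * b) m
coprime-* {a} a⊥m b⊥m {d} (d∣ab , d∣m) = b⊥m (coprime-divisor d⊥a d∣ab , d∣m)
  where
  d⊥a : Coprime d a
  d⊥a (e∣d , e∣a) = a⊥m (e∣a , ∣-trans e∣d d∣m)

coprime-maskProd : ∀ {A : Set} {m} (f : A → ℕ) {t} (b : Vec Bool t) xs →
  All (λ x → Coprime (f x) m) xs → Coprime (maskProd f b xs) m
coprime-maskProd f []          []       []       = 1-coprimeTo _
coprime-maskProd f (true  ∷ b) (x ∷ xs) (c ∷ cs) = coprime-* c (coprime-maskProd f b xs cs)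
coprime-maskProd f (false ∷ b) (x ∷ xs) (c ∷ cs) = coprime-maskProd f b xs cs

coprime-^ : ∀ {a p} → Coprime a p → ∀ k → Coprime a (p ^ k)
coprime-^ {a} a⊥p zero    = coprime-sym (1-coprimeTo a)
coprime-^ a⊥p (suc k) = coprime-sym (coprime-* (coprime-sym a⊥p) (coprime-sym (coprime-^ a⊥p k)))

∤⇒coprime : ∀ {p a} → Prime p → ¬ p ∣ a → Coprime a p
∤⇒coprime pp p∤a {d} (d∣a , d∣p) with prime⇒irreducible pp d∣p
... | inj₁ d≡1 = d≡1
... | inj₂ refl = ⊥-elim (p∤a d∣a)

-- Products of units modulo s

-- φ s is definitionally the length of units s, so indices into it lie in Fin (φ s).
units : ℕ → List ℕ
units s = filter (λ i → coprime? i s) (List.map suc (upTo s))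

coprime-% : ∀ {a s} .{{_ : NonZero s}} → Coprime a s → Coprime (a % s) s
coprime-% a⊥s (d∣r , d∣s) = a⊥s (∣n∣m%n⇒∣m d∣s d∣r , d∣s)

%-∈-units : ∀ {s a} .{{_ : NonZero s}} → 1 < s → Coprime a s → a % s ∈ units s
%-∈-units {s} {a} 1<s a⊥s with a % s in eq | coprime-% {a} a⊥s
... | zero  | 0⊥s = ⊥-elim (<⇒≢ 1<s (sym (0-coprimeTo-m⇒m≡1 0⊥s)))
... | suc r | r+1⊥s =
  ∈-filter⁺ (λ i → coprime? i s) (∈-map⁺ suc (∈-upTo⁺ (<⇒≤ (subst (_< s) eq (m%n<n a s))))) r+1⊥s

-- The Davenport property of (ℤ/sℤ)^×, for sequences of residues given through a weight g.
ProductOneProperty : ℕ → ℕ → Set₁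
ProductOneProperty s m = ∀ {A : Set} (g : A → ℕ) {L} (ys : Vec A L) →
  All (λ y → Coprime (g y) s) ys → m ≤ L →
  Σ (Vec Bool L) λ b → NonEmptyMask b × maskProd g b ys ≡ 1 mod s

maskProd-block≡1 : ∀ {A : Set} {s} (g : A → ℕ) {L} (ys : Vec A L) {i j} → i ≤ j →
  Coprime (maskProd g (prefix i) ys) s → maskProd g (prefix i) ys ≡ maskProd g (prefix j) ys mod s →
  maskProd g (block i j) ys ≡ 1 mod s
maskProd-block≡1 {s = s} g ys i≤j prefix⊥s prefixes≡ = ≡mod-sym (≡mod-cancelˡ prefix⊥s
  (subst₂ (_≡_mod s) (sym (*-identityʳ _)) (maskProd-prefix-block g ys i≤j) prefixes≡))

residues-pigeonhole : ∀ {s L} → 1 < s → (v : Fin (suc L) → ℕ) → (∀ i → Coprime (v i) s) → φ s ≤ L →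
  ∃₂ λ i j → toℕ i < toℕ j × v i ≡ v j mod s
residues-pigeonhole {s} 1<s v v⊥s φ≤L = sameResidue (pigeonhole (s≤s φ≤L) (index ∘ residue∈units))
  where
  instance
    s≢0 : NonZero s
    s≢0 = >-nonZero (<-trans z<s 1<s)
  residue∈units : ∀ i → v i % s ∈ units s
  residue∈units i = %-∈-units 1<s (v⊥s i)
  sameResidue : (∃₂ λ i j → toℕ i < toℕ j × index (residue∈units i) ≡ index (residue∈units j)) →
    ∃₂ λ i j → toℕ i < toℕ j × v i ≡ v j mod s
  sameResidue (i , j , i<j , same) = i , j , i<j , %≡⇒≡mod (begin
    v i % s                                    ≡⟨ lookup-index (residue∈units i) ⟩
    lookup (units s) (index (residue∈units i)) ≡⟨ cong (lookup (units s)) same ⟩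
    lookup (units s) (index (residue∈units j)) ≡⟨ lookup-index (residue∈units j) ⟨
    v j % s                                    ∎)
    where open ≡-Reasoning

-- Two of the L + 1 prefix products agree modulo s; the block between them has product 1.
productOne-φ : ∀ {s} → 1 < s → ProductOneProperty s (φ s)
productOne-φ {s} 1<s g {L} ys ys⊥s φ≤L =
  blockBetween (residues-pigeonhole 1<s (prefixProd ∘ toℕ) (prefix⊥s ∘ toℕ) φ≤L)
  where
  prefixProd : ℕ → ℕ
  prefixProd i = maskProd g (prefix i) ys
  prefix⊥s : ∀ i → Coprime (prefixProd i) s
  prefix⊥s i = coprime-maskProd g (prefix i) ys ys⊥s
  blockBetween : (∃₂ λ (i j : Fin (suc L)) → toℕ i < toℕ j × prefixProd (toℕ i) ≡ prefixProd (toℕ j) mod s) →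
    Σ (Vec Bool L) λ b → NonEmptyMask b × maskProd g b ys ≡ 1 mod s
  blockBetween (i , j , i<j , prefixes≡) = block (toℕ i) (toℕ j) , block-nonEmpty i<j (toℕ≤pred[n] j) ,
    maskProd-block≡1 g ys (<⇒≤ i<j) (prefix⊥s (toℕ i)) prefixes≡

m<n⇒m≤n∸1 : ∀ {m n} → m < n → m ≤ n ∸ 1
m<n⇒m≤n∸1 {n = suc n} (s≤s m≤n) = m≤n

-- Greedily merging product-one subsequences of the leftover entries leaves fewer than m entries unused.
long-productOne-subsequence : ∀ {s m} → ProductOneProperty s m →
  ∀ {A : Set} (g : A → ℕ) {L} (ys : Vec A L) → All (λ y → Coprime (g y) s) ys →
  Σ (Vec Bool L) λ b → maskProd g b ys ≡ 1 mod s × L ≤ count b + (m ∸ 1)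
long-productOne-subsequence one g [] [] = [] , ≡mod-refl 1 , z≤n
long-productOne-subsequence {s} {m} one g {suc L} (y ∷ ys) (u ∷ us)
  with b , b≡1 , L≤ ← long-productOne-subsequence one g ys us
  with m ≤? suc (count (∁ b))
... | no m≰ = false ∷ b , b≡1 , (begin
  suc L                        ≡⟨ cong suc (count-∁ b) ⟨
  suc (count (∁ b)) + count b  ≤⟨ +-monoˡ-≤ (count b) (m<n⇒m≤n∸1 (≰⇒> m≰)) ⟩
  (m ∸ 1) + count b            ≡⟨ +-comm (m ∸ 1) (count b) ⟩
  count b + (m ∸ 1)            ∎)
  where open ≤-Reasoning
... | yes m≤
  with b′ , b′≢∅ , b′≡1 ← one g (pick (∁ (false ∷ b)) (y ∷ ys)) (All-pick (∁ (false ∷ b)) (u ∷ us)) m≤ =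
  merge (false ∷ b) b′ ,
  subst (_≡ 1 mod s) (sym (maskProd-merge g (false ∷ b) b′ (y ∷ ys))) (≡mod-*-cong b′≡1 b≡1) ,
  (begin
  suc L                                     ≤⟨ s≤s L≤ ⟩
  suc (count b + (m ∸ 1))                   ≤⟨ +-monoˡ-≤ (count b + (m ∸ 1)) (nonEmpty⇒1≤count b′ b′≢∅) ⟩
  count b′ + (count b + (m ∸ 1))            ≡⟨ +-assoc (count b′) (count b) (m ∸ 1) ⟨
  count b′ + count b + (m ∸ 1)              ≡⟨ cong (_+ (m ∸ 1)) (count-merge (false ∷ b) b′) ⟨
  count (merge (false ∷ b) b′) + (m ∸ 1)    ∎)
  where open ≤-Reasoning

-- The units y + n / gcd(y, n)

module Cofactor (n : ℕ) .{{_ : NonZero n}} where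

  cofactor : ℕ → ℕ
  cofactor y = quotient (gcd[m,n]∣n y n)

  shift : ℕ → ℕ
  shift y = y + cofactor y

  n≡cofactor*gcd : ∀ y → n ≡ cofactor y * gcd y n
  n≡cofactor*gcd y = m∣n⇒n≡quotient*m (gcd[m,n]∣n y n)

  cofactor∣n : ∀ y → cofactor y ∣ n
  cofactor∣n y = quotient-∣ (gcd[m,n]∣n y n)

  shift-≡mod : ∀ y → y ≡ shift y mod cofactor y
  shift-≡mod y = 1 , 0 , trans (cong (y +_) (+-identityʳ (cofactor y))) (sym (+-identityʳ (shift y)))

  shift-coprime : ∀ y → Coprime (gcd y n) (cofactor y) → Coprime (shift y) n
  shift-coprime y g⊥w {c} (c∣shift , c∣n) = c⊥w (∣-refl , c∣w)
    where
    c⊥w : Coprime c (cofactor y)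
    c⊥w {e} (e∣c , e∣w) = g⊥w (gcd-greatest e∣y (∣-trans e∣w (cofactor∣n y)) , e∣w)
      where
      e∣y : e ∣ y
      e∣y = ∣m+n∣m⇒∣n (subst (e ∣_) (+-comm y (cofactor y)) (∣-trans e∣c c∣shift)) e∣w
    c∣gcd : c ∣ gcd y n
    c∣gcd = coprime-divisor c⊥w (subst (c ∣_) (n≡cofactor*gcd y) c∣n)
    c∣w : c ∣ cofactor y
    c∣w = ∣m+n∣m⇒∣n c∣shift (∣-trans c∣gcd (gcd[m,n]∣m y n))

  cofactor-antitone : ∀ {a b} → a ∣ b → cofactor b ∣ cofactor a
  cofactor-antitone {a} {b} a∣b
    with divides e gcd-b≡ ← gcd-greatest (∣-trans (gcd[m,n]∣m a n) a∣b) (gcd[m,n]∣n a n) =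
    divides e (*-cancelʳ-≡ (cofactor a) (e * cofactor b) (gcd a n) {{gcd≢0}} (begin
      cofactor a * gcd a n        ≡⟨ n≡cofactor*gcd a ⟨
      n                           ≡⟨ n≡cofactor*gcd b ⟩
      cofactor b * gcd b n        ≡⟨ cong (cofactor b *_) gcd-b≡ ⟩
      cofactor b * (e * gcd a n)  ≡⟨ x∙yz≡yx∙z (cofactor b) e (gcd a n) ⟩
      e * cofactor b * gcd a n    ∎))
    where
    open ≡-Reasoning
    gcd≢0 : NonZero (gcd a n)
    gcd≢0 = ≢-nonZero λ gcd≡0 → ≢-nonZero⁻¹ n (gcd[m,n]≡0⇒n≡0 a gcd≡0)
    x∙yz≡yx∙z : ∀ x y z → x * (y * z) ≡ y * x * z
    x∙yz≡yx∙z = solve-∀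

  maskProd-≡mod-shift : ∀ {A : Set} (f : A → ℕ) {t} (b : Vec Bool t) xs →
    maskProd f b xs ≡ maskProd (shift ∘ f) b xs mod cofactor (maskProd f b xs)
  maskProd-≡mod-shift f []          []       = ≡mod-refl 1
  maskProd-≡mod-shift f (true  ∷ b) (x ∷ xs) = ≡mod-*-cong
    (≡mod-∣ (cofactor-antitone {f x} (m∣m*n (maskProd f b xs))) (shift-≡mod (f x)))
    (≡mod-∣ (cofactor-antitone {maskProd f b xs} (n∣m*n (f x))) (maskProd-≡mod-shift f b xs))
  maskProd-≡mod-shift f (false ∷ b) (x ∷ xs) = maskProd-≡mod-shift f b xs

  -- P is 0 modulo gcd(P, n) and 1 modulo n / gcd(P, n); by the Chinese remainder theorem P² ≡ P.
  square≡-if-shiftProduct≡1 : ∀ {A : Set} (f : A → ℕ) {t} (b : Vec Bool t) xs →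
    let P = maskProd f b xs in
    Coprime (gcd P n) (cofactor P) → maskProd (shift ∘ f) b xs ≡ 1 mod n → P * P ≡ P mod n
  square≡-if-shiftProduct≡1 f b xs g⊥w shifts≡1 = subst (P * P ≡ P mod_) g*w≡n (≡mod-crt g⊥w
    (≡0mod⇒square≡ (∣⇒≡0mod (gcd[m,n]∣m P n)))
    (≡1mod⇒square≡ (≡mod-trans (maskProd-≡mod-shift f b xs) (≡mod-∣ (cofactor∣n P) shifts≡1))))
    where
    P = maskProd f b xs
    g*w≡n : gcd P n * cofactor P ≡ n
    g*w≡n = trans (*-comm (gcd P n) (cofactor P)) (sym (n≡cofactor*gcd P))

gcd⊥cofactor : ∀ {s b y} n .{{_ : NonZero n}} → n ≡ s * b → SquareFree s → Coprime y b →
  Coprime (gcd y n) (Cofactor.cofactor n y)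
gcd⊥cofactor {s} {b} {y} n n≡s*b sf y⊥b {c} (c∣g , c∣w) =
  sf c (coprime-divisor (coprime-* c⊥b c⊥b) (subst (c * c ∣_) g*w≡b*s (*-pres-∣ c∣g c∣w)))
  where
  open Cofactor n
  c⊥b : Coprime c b
  c⊥b (e∣c , e∣b) = y⊥b (∣-trans e∣c (∣-trans c∣g (gcd[m,n]∣m y n)) , e∣b)
  g*w≡b*s : gcd y n * cofactor y ≡ b * s
  g*w≡b*s = begin
    gcd y n * cofactor y  ≡⟨ *-comm (gcd y n) (cofactor y) ⟩
    cofactor y * gcd y n  ≡⟨ n≡cofactor*gcd y ⟨
    n                     ≡⟨ n≡s*b ⟩
    s * b                 ≡⟨ *-comm s b ⟩
    b * s                 ∎
    where open ≡-Reasoning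

HasIdempotentSubproduct : (n : ℕ) {t : ℕ} → Vec (Fin n) t → Set
HasIdempotentSubproduct n {t} zs =
  Σ (Vec Bool t) λ b → NonEmptyMask b × (let P = maskProd toℕ b zs in P * P ≡ P mod n)

embed-idempotentSubproduct : ∀ n .{{_ : NonZero n}} {t} (xs : Vec (Fin n) t) c →
  HasIdempotentSubproduct n (pick c xs) → Σ (Vec Bool t) (λ bs → NonEmptyMask bs × IsIdempotent n (selProd n bs xs))
embed-idempotentSubproduct n xs c (b , b≢∅ , P²≡P) = embed c b , embed-nonEmpty c b b≢∅ ,
  isIdempotent-selProd n (embed c b) xs
    (subst (λ P → P * P ≡ P mod n) (sym (maskProd-embed toℕ c b xs)) P²≡P)

small-summand⇒large-summand : ∀ {a b D k r} → 1 ≤ k → b + a ≡ D + (k ∸ 1) + r → b < D → k + r ≤ a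
small-summand⇒large-summand {a} {b} {D} {suc k} {r} _ b+a≡ b<D = +-cancelˡ-≤ b (suc k + r) a (begin
  b + (suc k + r)  ≡⟨ +-suc b (k + r) ⟩
  suc b + (k + r)  ≤⟨ +-monoˡ-≤ (k + r) b<D ⟩
  D + (k + r)      ≡⟨ +-assoc D k r ⟨
  D + k + r        ≡⟨ b+a≡ ⟨
  b + a            ∎)
  where open ≤-Reasoning

module _ {s p k : ℕ} (1<s : 1 < s) (sf : SquareFree s) (pp : Prime p) (p∤s : ¬ p ∣ s) (1≤k : 1 ≤ k) where

  private
    n : ℕ
    n = s * p ^ k

    instance
      s≢0 : NonZero s
      s≢0 = >-nonZero (<-trans z<s 1<s)
      n≢0 : NonZero n
      n≢0 = m*n≢0 s (p ^ k) {{s≢0}} {{m^n≢0 p k {{prime⇒nonZero pp}}}}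

    module Mod-s = Cofactor s
    module Mod-n = Cofactor n

    gcd⊥cofactorₛ : ∀ y → Coprime (gcd y s) (Mod-s.cofactor y)
    gcd⊥cofactorₛ y = gcd⊥cofactor {y = y} s (sym (*-identityʳ s)) sf (coprime-sym (1-coprimeTo y))

    gcd⊥cofactorₙ : ∀ y → Coprime y p → Coprime (gcd y n) (Mod-n.cofactor y)
    gcd⊥cofactorₙ y y⊥p = gcd⊥cofactor {y = y} n refl sf (coprime-^ y⊥p k)

    shiftₛ-coprime : ∀ (z : Fin n) → Coprime (Mod-s.shift (toℕ z)) s
    shiftₛ-coprime z = Mod-s.shift-coprime (toℕ z) (gcd⊥cofactorₛ (toℕ z))

    toUnit : Fin n → Fin n
    toUnit z = fromℕ< (m%n<n (Mod-n.shift (toℕ z)) n)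

    toUnit-isUnit : ∀ z → Coprime (toℕ z) p → IsUnit n (toUnit z)
    toUnit-isUnit z z⊥p = subst (λ u → Coprime u n) (sym (toℕ-fromℕ< _))
      (coprime-% (Mod-n.shift-coprime (toℕ z) (gcd⊥cofactorₙ (toℕ z) z⊥p)))

    maskProd-toUnit : ∀ {t} (b : Vec Bool t) zs →
      maskProd toℕ b (map toUnit zs) ≡ maskProd (Mod-n.shift ∘ toℕ) b zs mod n
    maskProd-toUnit b zs = subst (_≡ maskProd (Mod-n.shift ∘ toℕ) b zs mod n) (sym (maskProd-map toℕ toUnit b zs))
      (maskProd-cong toUnit-≡mod b zs)
      where
      toUnit-≡mod : ∀ z → toℕ (toUnit z) ≡ Mod-n.shift (toℕ z) mod n
      toUnit-≡mod z = subst (_≡ Mod-n.shift (toℕ z) mod n) (sym (toℕ-fromℕ< _)) (%-≡mod (Mod-n.shift (toℕ z)))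

    multipleOfP? : Decidable (λ (x : Fin n) → p ∣ toℕ x)
    multipleOfP? x = p ∣? toℕ x

  coprimeToP-idempotent : ∀ {D t} → DavenportProperty n D → D ≤ t → (zs : Vec (Fin n) t) →
    All (λ z → Coprime (toℕ z) p) zs → HasIdempotentSubproduct n zs
  coprimeToP-idempotent dav D≤t zs zs⊥p
    with b , b≢∅ , units≡1 ← DavenportProperty-mono D≤t dav (map toUnit zs)
                                (map⁺ (All-map (λ {z} → toUnit-isUnit z) zs⊥p)) =
    b , b≢∅ , Mod-n.square≡-if-shiftProduct≡1 toℕ b zs
      (gcd⊥cofactorₙ (maskProd toℕ b zs) (coprime-maskProd toℕ b zs zs⊥p))
      (≡mod-trans (≡mod-sym (maskProd-toUnit b zs)) (selProd≡1⇒maskProd≡1 n b (map toUnit zs) units≡1))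

  square≡-of-multiplesOfP : ∀ {t} (zs : Vec (Fin n) t) → All (λ z → p ∣ toℕ z) zs → (b : Vec Bool t) →
    k ≤ count b → maskProd (Mod-s.shift ∘ toℕ) b zs ≡ 1 mod s →
    let P = maskProd toℕ b zs in P * P ≡ P mod n
  square≡-of-multiplesOfP zs p∣zs b k≤|b| shifts≡1 = ≡mod-crt (coprime-^ (∤⇒coprime pp p∤s) k)
    (Mod-s.square≡-if-shiftProduct≡1 toℕ b zs (gcd⊥cofactorₛ (maskProd toℕ b zs)) shifts≡1)
    (≡0mod⇒square≡ (∣⇒≡0mod (∣-trans (^-monoʳ-∣ p k≤|b|) (^count∣maskProd toℕ b zs p∣zs))))

  multiplesOfP-idempotent : ∀ {t} → k + (φ s ∸ 1) ≤ t → (zs : Vec (Fin n) t) →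
    All (λ z → p ∣ toℕ z) zs → HasIdempotentSubproduct n zs
  multiplesOfP-idempotent {t} bound zs p∣zs =
    fromLongSubsequence
      (long-productOne-subsequence (productOne-φ 1<s) (Mod-s.shift ∘ toℕ) zs (universal shiftₛ-coprime zs))
    where
    fromLongSubsequence : (Σ (Vec Bool t) λ b → maskProd (Mod-s.shift ∘ toℕ) b zs ≡ 1 mod s × t ≤ count b + (φ s ∸ 1)) →
      HasIdempotentSubproduct n zs
    fromLongSubsequence (b , shifts≡1 , t≤) =
      b , 1≤count⇒nonEmpty b (≤-trans 1≤k k≤|b|) , square≡-of-multiplesOfP zs p∣zs b k≤|b| shifts≡1
      where
      k≤|b| : k ≤ count b
      k≤|b| = +-cancelʳ-≤ (φ s ∸ 1) k (count b) (≤-trans bound t≤)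

  EBProperty-fromDavenport : ∀ {D} → DavenportProperty n D → EBProperty n (D + (k ∸ 1) + (φ s ∸ 1))
  EBProperty-fromDavenport {D} dav xs = bySize (D ≤? count (∁ multiples))
    where
    multiples = satisfying multipleOfP? xs
    bySize : Dec (D ≤ count (∁ multiples)) → Σ _ (λ bs → NonEmptyMask bs × IsIdempotent n (selProd n bs xs))
    bySize (yes D≤) = embed-idempotentSubproduct n xs (∁ multiples)
      (coprimeToP-idempotent dav D≤ (pick (∁ multiples) xs)
        (All-map (∤⇒coprime pp) (All-pick-∁satisfying multipleOfP? xs)))
    bySize (no D≰) = embed-idempotentSubproduct n xs multiples
      (multiplesOfP-idempotent (small-summand⇒large-summand 1≤k (count-∁ multiples) (≰⇒> D≰))
        (pick multiples xs) (All-pick-satisfying multipleOfP? xs))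

theorem1p5 : (s p k : ℕ) → 1 < s → SquareFree s → Prime p → ¬ (p ∣ s) → 1 ≤ k →
    (I D : ℕ) → IsErdosBurgessConst (s * p ^ k) I → IsDavenportConst (s * p ^ k) D →
    I ≤ D + (k ∸ 1) + (φ s ∸ 1)
theorem1p5 s p k 1<s sf pp p∤s 1≤k I D (_ , _ , I-least) (1≤D , dav , _) =
  I-least (D + (k ∸ 1) + (φ s ∸ 1)) (≤-trans 1≤D (≤-trans (m≤m+n D (k ∸ 1)) (m≤m+n _ _)))
    (EBProperty-fromDavenport 1<s sf pp p∤s 1≤k dav)
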